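{- Let $n$ be a positive integer, $p\in\mathbb{N}_0$ and $x\in\mathbb{C}$ with $x\neq p+1$ and $\binom{x+k}{k}\neq0$ for $1\le k\le n$. Then \[ \sum_{k=1}^n\frac{\binom{p+k}{k}}{\binom{x+k}{k}}H_{p+k} =\frac{p+1}{p-x+1}\,\frac{\binom{p+n+1}{n}}{\binom{x+n}{n}}\left(H_{p+n+1}-\frac{1}{p-x+1}\right)-\frac{p+1}{p-x+1}H_{p}+\frac{x}{(p-x+1)^2}. \]
   Context: $H_0=0$ and $H_m=\sum_{j=1}^m \frac1j$ for $m\ge1$. For $z\in\mathbb{C}$ and $k\in\mathbb{N}_0$, $\binom{z}{k}=\frac{z(z-1)\cdots(z-k+1)}{k!}$. -}

module Defs where

open import Level using (Level; _⊔_) renaming (suc to lsuc)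
open import Data.Nat using (ℕ; zero; suc)
open import Relation.Nullary using (¬_)
open import Algebra.Bundles using (CommutativeRing)

-- A field, given as a commutative ring with a total inverse operation that is
-- a genuine multiplicative inverse on nonzero elements (the value of 0⁻¹ is
-- irrelevant; it is never used under the hypotheses of the theorem).
record Field (c ℓ : Level) : Set (lsuc (c ⊔ ℓ)) where
  field
    commutativeRing : CommutativeRing c ℓ
  open CommutativeRing commutativeRing public
  field
    _⁻¹      : Carrier → Carrier
    ⁻¹-cong  : ∀ {x y} → x ≈ y → x ⁻¹ ≈ y ⁻¹
    inverseʳ : ∀ x → ¬ (x ≈ 0#) → x * (x ⁻¹) ≈ 1#
    0≉1      : ¬ (0# ≈ 1#)

module FieldOps {c ℓ : Level} (F : Field c ℓ) where
  open Field F

  ι : ℕ → Carrier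
  ι zero    = 0#
  ι (suc m) = 1# + ι m

  infixl 7 _/_
  _/_ : Carrier → Carrier → Carrier
  x / y = x * (y ⁻¹)

  falling : Carrier → ℕ → Carrier
  falling z zero    = 1#
  falling z (suc k) = falling z k * (z - ι k)

  fact : ℕ → Carrier
  fact zero    = 1#
  fact (suc k) = ι (suc k) * fact k

  binom : Carrier → ℕ → Carrier
  binom z k = falling z k / fact k

  sum1 : ℕ → (ℕ → Carrier) → Carrier
  sum1 zero    f = 0#
  sum1 (suc n) f = sum1 n f + f (suc n)

  H : ℕ → Carrier
  H m = sum1 m (λ j → 1# / ι j)

CharZero : {c ℓ : Level} → Field c ℓ → Set ℓ
CharZero F = ∀ m → ¬ (ι (suc m) ≈ 0#)
  where open Field F
        open FieldOps F

-- Write d = p - x + 1, r_n = C(p+n+1, n) / binom(x+n, n) and e = x + n + 1.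
-- Absorption, (n+1) C(N+1, n+1) = (N+1) C(N, n), together with
-- binom(x+n+1, n+1) = binom(x+n, n) e / (n+1) gives r_{n+1} = (p+n+2) r_n / e and
-- turns the (n+1)-st summand into (p+1) r_n H_{p+n+1} / e.  Since p+n+2 = d + e
-- and H_{p+n+2} = H_{p+n+1} + 1/(p+n+2), the right-hand side grows by exactly
-- this summand when n increases, and it vanishes at n = 0.

module Submission where

open import Defs
open import Data.Nat using (ℕ; zero; suc; _≤_; s≤s; z≤n) renaming (_+_ to _+ℕ_; _*_ to _*ℕ_)
open import Data.Nat.Combinatorics using (_C_)
open import Relation.Nullary using (¬_)
open import Data.Integer.Base using (+_)
open import Relation.Binary.PropositionalEquality using (_≡_; cong)
open import Algebra.Bundles using (CommutativeRing)

module BinomialAbsorption where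
  open import Data.Nat
  open import Data.Nat.Properties
  open import Data.Nat.Combinatorics
  open import Data.Nat.Tactic.RingSolver using (solve-∀)
  open import Relation.Binary.PropositionalEquality
  open ≡-Reasoning

  [1+k]*[1+n]C[1+k]≡[1+n]*nCk : ∀ n k → suc k * (suc n C suc k) ≡ suc n * (n C k)
  [1+k]*[1+n]C[1+k]≡[1+n]*nCk zero    zero    = refl
  [1+k]*[1+n]C[1+k]≡[1+n]*nCk zero    (suc k) = *-zeroʳ (suc (suc k))
  [1+k]*[1+n]C[1+k]≡[1+n]*nCk (suc n) zero    = begin
    1 * (suc (suc n) C 1) ≡⟨ *-identityˡ _ ⟩
    suc (suc n) C 1       ≡⟨ nC1≡n (suc (suc n)) ⟩
    suc (suc n)           ≡⟨ *-identityʳ _ ⟨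
    suc (suc n) * 1       ∎
  [1+k]*[1+n]C[1+k]≡[1+n]*nCk (suc n) (suc k) = begin
    suc (suc k) * (suc (suc n) C suc (suc k))
      ≡⟨ cong (suc (suc k) *_) (nCk+nC[k+1]≡[n+1]C[k+1] (suc n) (suc k)) ⟨
    suc (suc k) * (c + suc n C suc (suc k))  ≡⟨ split k c (suc n C suc (suc k)) ⟩
    suc k * c + c + suc (suc k) * (suc n C suc (suc k))
      ≡⟨ cong₂ (λ u v → u + c + v)
               ([1+k]*[1+n]C[1+k]≡[1+n]*nCk n k) ([1+k]*[1+n]C[1+k]≡[1+n]*nCk n (suc k)) ⟩
    suc n * (n C k) + c + suc n * (n C suc k) ≡⟨ join n (n C k) (n C suc k) c ⟩
    suc n * (n C k + n C suc k) + c          ≡⟨ cong (λ u → suc n * u + c) (nCk+nC[k+1]≡[n+1]C[k+1] n k) ⟩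
    suc n * c + c                            ≡⟨ +-comm (suc n * c) c ⟩
    suc (suc n) * c                          ∎
    where
    c = suc n C suc k
    split : ∀ k a b → suc (suc k) * (a + b) ≡ suc k * a + a + suc (suc k) * b
    split = solve-∀
    join : ∀ n a b c → suc n * a + c + suc n * b ≡ suc n * (a + b) + c
    join = solve-∀

  [1+k]*[m+k+1]C[1+k]≡[m+1]*[m+k+1]Ck : ∀ m k → suc k * ((m + k + 1) C suc k) ≡ (m + 1) * ((m + k + 1) C k)
  [1+k]*[m+k+1]C[1+k]≡[m+1]*[m+k+1]Ck m k = +-cancelˡ-≡ (suc k * a) _ _ (begin
    suc k * a + suc k * b     ≡⟨ *-distribˡ-+ (suc k) a b ⟨
    suc k * (a + b)           ≡⟨ cong (suc k *_) (nCk+nC[k+1]≡[n+1]C[k+1] n k) ⟩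
    suc k * (suc n C suc k)   ≡⟨ [1+k]*[1+n]C[1+k]≡[1+n]*nCk n k ⟩
    suc n * a                 ≡⟨ cong (_* a) (1+n≡[1+k]+[m+1] m k) ⟩
    (suc k + (m + 1)) * a     ≡⟨ *-distribʳ-+ a (suc k) (m + 1) ⟩
    suc k * a + (m + 1) * a   ∎)
    where
    n = m + k + 1
    a = n C k
    b = n C suc k
    1+n≡[1+k]+[m+1] : ∀ m k → suc (m + k + 1) ≡ suc k + (m + 1)
    1+n≡[1+k]+[m+1] = solve-∀

-- Multiples are taken with the TCOptimised _×_, so that fromℤ (+ 1) reduces
-- to 1# and the solver constant con (+ 1) matches 1# in goals.
module IntegerCoefficients {c ℓ} (R : CommutativeRing c ℓ) where
  open CommutativeRing R
  open import Algebra.Properties.Ring ring using (-0#≈0#; -‿involutive; -‿+-comm; -‿distribˡ-*)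
  open import Algebra.Properties.CommutativeSemigroup +-commutativeSemigroup
    using () renaming (interchange to +-interchange)
  open import Algebra.Properties.CommutativeSemigroup *-commutativeSemigroup
    using () renaming (interchange to *-interchange)
  open import Algebra.Properties.Semiring.Mult.TCOptimised semiring using (_×_; 1+×; ×-homo-+; ×1-homo-*)
  open import Algebra.Solver.Ring.AlmostCommutativeRing
    using (_-Raw-AlmostCommutative⟶_; fromCommutativeRing)
  open import Data.Integer.Base as ℤ using (ℤ; -[1+_]; _⊖_; _◃_; sign; ∣_∣)
  open import Data.Integer.Properties using (_≟_; [1+m]⊖[1+n]≡m⊖n; signᵢ◃∣i∣≡i)
  import Data.Nat.Base as ℕ
  open import Data.Nat.Properties using (+-suc)
  open import Data.Sign.Base as Sign using (Sign)
  open import Data.Maybe.Base using (Maybe; just; nothing)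
  open import Relation.Nullary.Decidable using (yes; no)
  import Relation.Binary.PropositionalEquality.Core as ≡
  open import Relation.Binary.Reasoning.Setoid setoid

  fromℤ : ℤ → Carrier
  fromℤ (+ n)    = n × 1#
  fromℤ -[1+ n ] = - (suc n × 1#)

  private
    [1+a]-[1+b]≈a-b : ∀ a b → (1# + a) - (1# + b) ≈ a - b
    [1+a]-[1+b]≈a-b a b = begin
      (1# + a) - (1# + b)      ≈⟨ +-congˡ (-‿+-comm 1# b) ⟨
      (1# + a) + (- 1# + - b)  ≈⟨ +-interchange 1# a (- 1#) (- b) ⟩
      (1# - 1#) + (a - b)      ≈⟨ +-congʳ (-‿inverseʳ 1#) ⟩
      0# + (a - b)             ≈⟨ +-identityˡ _ ⟩
      a - b                    ∎

    fromℤ-⊖ : ∀ m n → fromℤ (m ⊖ n) ≈ m × 1# - n × 1#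
    fromℤ-⊖ m       zero    = sym (trans (+-congˡ -0#≈0#) (+-identityʳ _))
    fromℤ-⊖ zero    (suc n) = sym (+-identityˡ _)
    fromℤ-⊖ (suc m) (suc n) rewrite [1+m]⊖[1+n]≡m⊖n m n = begin
      fromℤ (m ⊖ n)                      ≈⟨ fromℤ-⊖ m n ⟩
      m × 1# - n × 1#                    ≈⟨ [1+a]-[1+b]≈a-b _ _ ⟨
      (1# + m × 1#) - (1# + n × 1#)      ≈⟨ +-cong (1+× m 1#) (-‿cong (1+× n 1#)) ⟨
      suc m × 1# - suc n × 1#            ∎

    fromℤ-+ : ∀ i j → fromℤ (i ℤ.+ j) ≈ fromℤ i + fromℤ j
    fromℤ-+ -[1+ m ] -[1+ n ] = begin
      - (suc (suc (m ℕ.+ n)) × 1#)       ≡⟨ ≡.cong (λ k → - (suc k × 1#)) (+-suc m n) ⟨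
      - ((suc m ℕ.+ suc n) × 1#)         ≈⟨ -‿cong (×-homo-+ 1# (suc m) (suc n)) ⟩
      - (suc m × 1# + suc n × 1#)        ≈⟨ -‿+-comm _ _ ⟨
      - (suc m × 1#) + - (suc n × 1#)    ∎
    fromℤ-+ -[1+ m ] (+ n)    = trans (fromℤ-⊖ n (suc m)) (+-comm _ _)
    fromℤ-+ (+ m)    -[1+ n ] = fromℤ-⊖ m (suc n)
    fromℤ-+ (+ m)    (+ n)    = ×-homo-+ 1# m n

    fromℤ-neg : ∀ i → fromℤ (ℤ.- i) ≈ - fromℤ i
    fromℤ-neg -[1+ n ]     = sym (-‿involutive _)
    fromℤ-neg (+ zero)     = sym -0#≈0#
    fromℤ-neg (+ suc n)    = refl

    fromSign : Sign → Carrier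
    fromSign Sign.+ = 1#
    fromSign Sign.- = - 1#

    fromSign-* : ∀ s t → fromSign (s Sign.* t) ≈ fromSign s * fromSign t
    fromSign-* Sign.- Sign.- = sym (begin
      - 1# * - 1#   ≈⟨ -‿distribˡ-* 1# (- 1#) ⟨
      - (1# * - 1#) ≈⟨ -‿cong (*-identityˡ _) ⟩
      - - 1#        ≈⟨ -‿involutive 1# ⟩
      1#            ∎)
    fromSign-* Sign.- Sign.+ = sym (*-identityʳ _)
    fromSign-* Sign.+ t      = sym (*-identityˡ _)

    fromℤ-◃ : ∀ s n → fromℤ (s ◃ n) ≈ fromSign s * n × 1#
    fromℤ-◃ s      zero    = sym (zeroʳ _)
    fromℤ-◃ Sign.+ (suc n) = sym (*-identityˡ _)
    fromℤ-◃ Sign.- (suc n) = trans (-‿cong (sym (*-identityˡ _))) (-‿distribˡ-* 1# _)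

    fromℤ-* : ∀ i j → fromℤ (i ℤ.* j) ≈ fromℤ i * fromℤ j
    fromℤ-* i j = begin
      fromℤ (i ℤ.* j)
        ≈⟨ fromℤ-◃ (sign i Sign.* sign j) (∣ i ∣ ℕ.* ∣ j ∣) ⟩
      fromSign (sign i Sign.* sign j) * (∣ i ∣ ℕ.* ∣ j ∣) × 1#
        ≈⟨ *-cong (fromSign-* (sign i) (sign j)) (×1-homo-* ∣ i ∣ ∣ j ∣) ⟩
      (fromSign (sign i) * fromSign (sign j)) * (∣ i ∣ × 1# * ∣ j ∣ × 1#)
        ≈⟨ *-interchange _ _ _ _ ⟩
      (fromSign (sign i) * ∣ i ∣ × 1#) * (fromSign (sign j) * ∣ j ∣ × 1#)
        ≈⟨ *-cong (fromℤ-◃ (sign i) ∣ i ∣) (fromℤ-◃ (sign j) ∣ j ∣) ⟨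
      fromℤ (sign i ◃ ∣ i ∣) * fromℤ (sign j ◃ ∣ j ∣)
        ≡⟨ ≡.cong₂ (λ u v → fromℤ u * fromℤ v) (signᵢ◃∣i∣≡i i) (signᵢ◃∣i∣≡i j) ⟩
      fromℤ i * fromℤ j ∎

  fromℤ-homomorphism : ℤ.+-*-rawRing -Raw-AlmostCommutative⟶ fromCommutativeRing R
  fromℤ-homomorphism = record
    { ⟦_⟧ = fromℤ ; +-homo = fromℤ-+ ; *-homo = fromℤ-* ; -‿homo = fromℤ-neg
    ; 0-homo = refl ; 1-homo = refl
    }

  private
    fromℤ-≟ : ∀ i j → Maybe (fromℤ i ≈ fromℤ j)
    fromℤ-≟ i j with i ≟ j
    ... | yes ≡.refl = just refl
    ... | no _       = nothing

  open import Algebra.Solver.Ring ℤ.+-*-rawRing (fromCommutativeRing R) fromℤ-homomorphism fromℤ-≟ public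

module FieldProperties {c ℓ} (F : Field c ℓ) where
  open Field F
  open import Relation.Binary.Reasoning.Setoid setoid

  1≉0 : ¬ (1# ≈ 0#)
  1≉0 1≈0 = 0≉1 (sym 1≈0)

  x*y≈1⇒x≉0 : ∀ {x y} → x * y ≈ 1# → ¬ (x ≈ 0#)
  x*y≈1⇒x≉0 {x} {y} xy≈1 x≈0 = 0≉1 (begin
    0#     ≈⟨ zeroˡ y ⟨
    0# * y ≈⟨ *-congʳ x≈0 ⟨
    x * y  ≈⟨ xy≈1 ⟩
    1#     ∎)

  x*y≉0⇒x≉0 : ∀ {x y} → ¬ (x * y ≈ 0#) → ¬ (x ≈ 0#)
  x*y≉0⇒x≉0 {x} {y} xy≉0 x≈0 = xy≉0 (trans (*-congʳ x≈0) (zeroˡ y))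

  x*y≉0⇒y≉0 : ∀ {x y} → ¬ (x * y ≈ 0#) → ¬ (y ≈ 0#)
  x*y≉0⇒y≉0 {x} {y} xy≉0 = x*y≉0⇒x≉0 (λ yx≈0 → xy≉0 (trans (*-comm x y) yx≈0))

  ⁻¹-inverseˡ : ∀ {x} → ¬ (x ≈ 0#) → x ⁻¹ * x ≈ 1#
  ⁻¹-inverseˡ {x} x≉0 = trans (*-comm (x ⁻¹) x) (inverseʳ x x≉0)

  ⁻¹-unique : ∀ {x y} → x * y ≈ 1# → y ≈ x ⁻¹
  ⁻¹-unique {x} {y} xy≈1 = begin
    y                ≈⟨ *-identityʳ y ⟨
    y * 1#           ≈⟨ *-congˡ (inverseʳ x (x*y≈1⇒x≉0 xy≈1)) ⟨
    y * (x * x ⁻¹)   ≈⟨ *-assoc y x (x ⁻¹) ⟨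
    (y * x) * x ⁻¹   ≈⟨ *-congʳ (trans (*-comm y x) xy≈1) ⟩
    1# * x ⁻¹        ≈⟨ *-identityˡ (x ⁻¹) ⟩
    x ⁻¹             ∎

  x*y≉0 : ∀ {x y} → ¬ (x ≈ 0#) → ¬ (y ≈ 0#) → ¬ (x * y ≈ 0#)
  x*y≉0 {x} {y} x≉0 y≉0 xy≈0 = y≉0 (begin
    y                ≈⟨ *-identityˡ y ⟨
    1# * y           ≈⟨ *-congʳ (⁻¹-inverseˡ x≉0) ⟨
    (x ⁻¹ * x) * y   ≈⟨ *-assoc (x ⁻¹) x y ⟩
    x ⁻¹ * (x * y)   ≈⟨ *-congˡ xy≈0 ⟩
    x ⁻¹ * 0#        ≈⟨ zeroʳ (x ⁻¹) ⟩
    0#               ∎)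

  x⁻¹≉0 : ∀ {x} → ¬ (x ≈ 0#) → ¬ (x ⁻¹ ≈ 0#)
  x⁻¹≉0 x≉0 = x*y≈1⇒x≉0 (⁻¹-inverseˡ x≉0)

  ⁻¹-involutive : ∀ {x} → ¬ (x ≈ 0#) → x ⁻¹ ⁻¹ ≈ x
  ⁻¹-involutive x≉0 = sym (⁻¹-unique (⁻¹-inverseˡ x≉0))

  ⁻¹-distrib-* : ∀ {x y} → ¬ (x ≈ 0#) → ¬ (y ≈ 0#) → (x * y) ⁻¹ ≈ x ⁻¹ * y ⁻¹
  ⁻¹-distrib-* {x} {y} x≉0 y≉0 = sym (⁻¹-unique (begin
    (x * y) * (x ⁻¹ * y ⁻¹)   ≈⟨ *-assoc x y _ ⟩
    x * (y * (x ⁻¹ * y ⁻¹))   ≈⟨ *-congˡ (x∙yz≈y∙xz y (x ⁻¹) (y ⁻¹)) ⟩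
    x * (x ⁻¹ * (y * y ⁻¹))   ≈⟨ *-assoc x (x ⁻¹) _ ⟨
    (x * x ⁻¹) * (y * y ⁻¹)   ≈⟨ *-cong (inverseʳ x x≉0) (inverseʳ y y≉0) ⟩
    1# * 1#                   ≈⟨ *-identityˡ 1# ⟩
    1#                        ∎))
    where open import Algebra.Properties.CommutativeSemigroup *-commutativeSemigroup using (x∙yz≈y∙xz)

  1⁻¹≈1 : 1# ⁻¹ ≈ 1#
  1⁻¹≈1 = trans (sym (*-identityˡ (1# ⁻¹))) (inverseʳ 1# 1≉0)

module GeneralisedBinomial {c ℓ} (F : Field c ℓ) (char0 : CharZero F) where
  open Field F
  open FieldOps F
  open FieldProperties F
  open IntegerCoefficients commutativeRing
  open import Relation.Binary.Reasoning.Setoid setoid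

  ι-homo-+ : ∀ m n → ι (m +ℕ n) ≈ ι m + ι n
  ι-homo-+ zero    n = sym (+-identityˡ (ι n))
  ι-homo-+ (suc m) n = trans (+-congˡ (ι-homo-+ m n)) (sym (+-assoc 1# (ι m) (ι n)))

  ι-homo-* : ∀ m n → ι (m *ℕ n) ≈ ι m * ι n
  ι-homo-* zero    n = sym (zeroˡ (ι n))
  ι-homo-* (suc m) n = begin
    ι (n +ℕ m *ℕ n)         ≈⟨ ι-homo-+ n (m *ℕ n) ⟩
    ι n + ι (m *ℕ n)        ≈⟨ +-congˡ (ι-homo-* m n) ⟩
    ι n + ι m * ι n        ≈⟨ +-congʳ (*-identityˡ (ι n)) ⟨
    1# * ι n + ι m * ι n   ≈⟨ distribʳ (ι n) 1# (ι m) ⟨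
    (1# + ι m) * ι n       ∎

  fact≉0 : ∀ k → ¬ (fact k ≈ 0#)
  fact≉0 zero    = 1≉0
  fact≉0 (suc k) = x*y≉0 (char0 k) (fact≉0 k)

  falling-cong : ∀ {z w} k → z ≈ w → falling z k ≈ falling w k
  falling-cong zero    z≈w = refl
  falling-cong (suc k) z≈w = *-cong (falling-cong k z≈w) (+-congʳ z≈w)

  falling-suc : ∀ z k → falling z (suc k) ≈ z * falling (z - 1#) k
  falling-suc z zero    = solve 1 (λ z → con (+ 1) :* (z :- con (+ 0)) := z :* con (+ 1)) refl z
  falling-suc z (suc k) = begin
    falling z (suc k) * (z - ι (suc k))          ≈⟨ *-congʳ (falling-suc z k) ⟩
    (z * falling (z - 1#) k) * (z - ι (suc k))
      ≈⟨ solve 3 (λ z f i → (z :* f) :* (z :- (con (+ 1) :+ i)) := z :* (f :* (z :- con (+ 1) :- i)))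
               refl z (falling (z - 1#) k) (ι k) ⟩
    z * falling (z - 1#) (suc k)                 ∎

  binom-zero : ∀ z → binom z 0 ≈ 1#
  binom-zero z = inverseʳ 1# 1≉0

  binom-suc : ∀ z k → binom z (suc k) ≈ binom (z - 1#) k * (z / ι (suc k))
  binom-suc z k = begin
    falling z (suc k) * (ι (suc k) * fact k) ⁻¹
      ≈⟨ *-cong (falling-suc z k) (⁻¹-distrib-* (char0 k) (fact≉0 k)) ⟩
    (z * falling (z - 1#) k) * (ι (suc k) ⁻¹ * fact k ⁻¹)
      ≈⟨ solve 4 (λ z f m g → (z :* f) :* (m :* g) := (f :* g) :* (z :* m))
                 refl z (falling (z - 1#) k) (ι (suc k) ⁻¹) (fact k ⁻¹) ⟩
    binom (z - 1#) k * (z / ι (suc k)) ∎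

module Telescoping {c ℓ} (R : CommutativeRing c ℓ) where
  open CommutativeRing R
  open IntegerCoefficients R
  open import Algebra.Properties.Ring ring using (x≈y⇒x∙y⁻¹≈ε)
  open import Relation.Binary.Reasoning.Setoid setoid

  -- The hypotheses enter only through the error terms d D - 1, e E - 1 and (d + e) Q - 1,
  -- which is what makes the middle step a plain ring identity.
  telescoping-step : ∀ {d e q D E Q} → d * D ≈ 1# → e * E ≈ 1# → q * Q ≈ 1# → q ≈ d + e →
    ∀ P r h → (P * D) * (q * r * E) * ((h + 1# * Q) - 1# * D)
                ≈ (P * D) * r * (h - 1# * D) + P * r * E * h
  telescoping-step {d} {e} {q} {D} {E} {Q} dD≈1 eE≈1 qQ≈1 q≈d+e P r h = begin
    (P * D) * (q * r * E) * ((h + 1# * Q) - 1# * D)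
      ≈⟨ *-congʳ (*-congˡ (*-congʳ (*-congʳ q≈d+e))) ⟩
    (P * D) * ((d + e) * r * E) * ((h + 1# * Q) - 1# * D)
      ≈⟨ solve 8 (λ P D r d e E Q h →
           (P :* D) :* ((d :+ e) :* r :* E) :* ((h :+ con (+ 1) :* Q) :- con (+ 1) :* D)
           := (P :* D) :* r :* (h :- con (+ 1) :* D) :+ P :* r :* E :* h
              :+ P :* r :* E :* (h :- con (+ 1) :* D) :* (d :* D :- con (+ 1))
              :+ P :* D :* r :* (h :- con (+ 1) :* D) :* (e :* E :- con (+ 1))
              :+ P :* D :* r :* E :* ((d :+ e) :* Q :- con (+ 1)))
           refl P D r d e E Q h ⟩
    lhs + a * (d * D - 1#) + b * (e * E - 1#) + g * ((d + e) * Q - 1#)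
      ≈⟨ +-cong (+-cong (+-congˡ (*-congˡ (x≈y⇒x∙y⁻¹≈ε dD≈1))) (*-congˡ (x≈y⇒x∙y⁻¹≈ε eE≈1)))
                (*-congˡ (x≈y⇒x∙y⁻¹≈ε (trans (*-congʳ (sym q≈d+e)) qQ≈1))) ⟩
    lhs + a * 0# + b * 0# + g * 0#
      ≈⟨ solve 4 (λ l a b g → l :+ a :* con (+ 0) :+ b :* con (+ 0) :+ g :* con (+ 0) := l) refl lhs a b g ⟩
    lhs ∎
    where
    lhs = (P * D) * r * (h - 1# * D) + P * r * E * h
    a = P * r * E * (h - 1# * D)
    b = P * D * r * (h - 1# * D)
    g = P * D * r * E

module HarmonicBinomialSum {c ℓ} (F : Field c ℓ) (char0 : CharZero F) where
  open Field F
  open FieldOps F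
  open FieldProperties F
  open GeneralisedBinomial F char0
  open Telescoping commutativeRing
  open IntegerCoefficients commutativeRing
  open BinomialAbsorption
  import Data.Nat.Properties as ℕ
  import Relation.Binary.PropositionalEquality as ≡
  open import Algebra.Properties.Ring ring using (x≈y⇒x∙y⁻¹≈ε)
  open import Relation.Binary.Reasoning.Setoid setoid

  module _ (p : ℕ) (x : Carrier) (x≉p+1 : ¬ (x ≈ ι (p +ℕ 1))) where
    d : Carrier
    d = ι p - x + 1#

    d≉0 : ¬ (d ≈ 0#)
    d≉0 d≈0 = x≉p+1 (begin
      x          ≈⟨ +-identityʳ x ⟨
      x + 0#     ≈⟨ +-congˡ d≈0 ⟨
      x + d      ≈⟨ solve 2 (λ x i → x :+ (i :- x :+ con (+ 1)) := con (+ 1) :+ i) refl x (ι p) ⟩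
      ι (suc p)  ≡⟨ cong ι (ℕ.+-comm 1 p) ⟩
      ι (p +ℕ 1) ∎)

    ratio : ℕ → Carrier
    ratio n = ι ((p +ℕ n +ℕ 1) C n) / binom (x + ι n) n

    summand : ℕ → Carrier
    summand k = (ι ((p +ℕ k) C k) / binom (x + ι k) k) * H (p +ℕ k)

    rhs : ℕ → Carrier
    rhs n = (ι (p +ℕ 1) / d) * ratio n * (H (p +ℕ n +ℕ 1) - 1# / d) - (ι (p +ℕ 1) / d) * H p + x / (d * d)

    ratio-zero : ratio 0 ≈ 1#
    ratio-zero = trans (*-cong (+-identityʳ 1#) (trans (⁻¹-cong (binom-zero (x + ι 0))) 1⁻¹≈1)) (*-identityˡ 1#)

    rhs-zero : rhs 0 ≈ 0#
    rhs-zero = begin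
      rhs 0
        ≈⟨ +-cong (+-cong (*-cong (*-cong (*-congʳ P≈s) ratio-zero) (+-congʳ (reflexive (cong H p+0+1≡1+p))))
                          (-‿cong (*-congʳ (*-congʳ P≈s))))
                  (*-congˡ (⁻¹-distrib-* d≉0 d≉0)) ⟩
      (s * D) * 1# * ((H p + 1# * S) - 1# * D) - (s * D) * H p + x * (D * D)
        ≈⟨ solve 5 (λ i x D S Hp →
             ((con (+ 1) :+ i) :* D) :* con (+ 1) :* ((Hp :+ con (+ 1) :* S) :- con (+ 1) :* D)
               :- ((con (+ 1) :+ i) :* D) :* Hp :+ x :* (D :* D)
             := D :* ((con (+ 1) :+ i) :* S :- con (+ 1)) :- D :* ((i :- x :+ con (+ 1)) :* D :- con (+ 1)))
             refl (ι p) x D S (H p) ⟩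
      D * (s * S - 1#) - D * (d * D - 1#)
        ≈⟨ +-cong (*-congˡ (x≈y⇒x∙y⁻¹≈ε (inverseʳ s (char0 p))))
                  (-‿cong (*-congˡ (x≈y⇒x∙y⁻¹≈ε (inverseʳ d d≉0)))) ⟩
      D * 0# - D * 0#
        ≈⟨ solve 1 (λ D → D :* con (+ 0) :- D :* con (+ 0) := con (+ 0)) refl D ⟩
      0# ∎
      where
      s = ι (suc p)
      S = s ⁻¹
      D = d ⁻¹
      P≈s : ι (p +ℕ 1) ≈ s
      P≈s = reflexive (cong ι (ℕ.+-comm p 1))
      p+0+1≡1+p : p +ℕ 0 +ℕ 1 ≡ suc p
      p+0+1≡1+p = ≡.trans (cong (_+ℕ 1) (ℕ.+-identityʳ p)) (ℕ.+-comm p 1)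

    module Step (n : ℕ) (b′≉0 : ¬ (binom (x + ι (suc n)) (suc n) ≈ 0#)) where
      M : ℕ
      M = p +ℕ n +ℕ 1

      p+[1+n]≡M : p +ℕ suc n ≡ M
      p+[1+n]≡M = ≡.trans (ℕ.+-suc p n) (ℕ.+-comm 1 (p +ℕ n))

      p+[1+n]+1≡1+M : p +ℕ suc n +ℕ 1 ≡ suc M
      p+[1+n]+1≡1+M = cong (_+ℕ 1) (ℕ.+-suc p n)

      b e m q : Carrier
      b = binom (x + ι n) n
      e = x + ι (suc n)
      m = ι (suc n)
      q = ι (suc M)

      b′≈b*e/m : binom e (suc n) ≈ b * (e / m)
      b′≈b*e/m = trans (binom-suc e n) (*-congʳ (*-congʳ (falling-cong n e-1≈x+n)))
        where
        e-1≈x+n : e - 1# ≈ x + ι n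
        e-1≈x+n = solve 2 (λ x i → x :+ (con (+ 1) :+ i) :- con (+ 1) := x :+ i) refl x (ι n)

      e≉0 : ¬ (e ≈ 0#)
      e≉0 = x*y≉0⇒x≉0 (x*y≉0⇒y≉0 (λ b*e/m≈0 → b′≉0 (trans b′≈b*e/m b*e/m≈0)))

      b′⁻¹≈b⁻¹*e⁻¹*m : binom e (suc n) ⁻¹ ≈ b ⁻¹ * (e ⁻¹ * m)
      b′⁻¹≈b⁻¹*e⁻¹*m = begin
        binom e (suc n) ⁻¹   ≈⟨ ⁻¹-cong b′≈b*e/m ⟩
        (b * (e / m)) ⁻¹     ≈⟨ ⁻¹-distrib-* b≉0 (x*y≉0 e≉0 m⁻¹≉0) ⟩
        b ⁻¹ * (e / m) ⁻¹    ≈⟨ *-congˡ (⁻¹-distrib-* e≉0 m⁻¹≉0) ⟩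
        b ⁻¹ * (e ⁻¹ * m ⁻¹ ⁻¹) ≈⟨ *-congˡ (*-congˡ (⁻¹-involutive (char0 n))) ⟩
        b ⁻¹ * (e ⁻¹ * m)    ∎
        where
        m⁻¹≉0 = x⁻¹≉0 (char0 n)
        b≉0 = x*y≉0⇒x≉0 (λ b*e/m≈0 → b′≉0 (trans b′≈b*e/m b*e/m≈0))

      -- As binom e (suc n) = b e / m, dividing by it needs the numerator times m,
      -- which is what the absorption identities supply.
      divide-by-b′ : ∀ {u v w} → m * u ≈ v * w → u / binom e (suc n) ≈ v * (w / b) * e ⁻¹
      divide-by-b′ {u} {v} {w} mu≈vw = begin
        u * binom e (suc n) ⁻¹         ≈⟨ *-congˡ b′⁻¹≈b⁻¹*e⁻¹*m ⟩
        u * (b ⁻¹ * (e ⁻¹ * m))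
          ≈⟨ solve 4 (λ u B E m → u :* (B :* (E :* m)) := (m :* u) :* B :* E) refl u (b ⁻¹) (e ⁻¹) m ⟩
        (m * u) * b ⁻¹ * e ⁻¹          ≈⟨ *-congʳ (*-congʳ mu≈vw) ⟩
        (v * w) * b ⁻¹ * e ⁻¹          ≈⟨ *-congʳ (*-assoc v w (b ⁻¹)) ⟩
        v * (w / b) * e ⁻¹             ∎

      q≈d+e : q ≈ d + e
      q≈d+e = begin
        1# + ι M                      ≈⟨ +-congˡ (trans (ι-homo-+ (p +ℕ n) 1) (+-congʳ (ι-homo-+ p n))) ⟩
        1# + ((ι p + ι n) + ι 1)      ≈⟨ solve 3 (λ i j x → con (+ 1) :+ ((i :+ j) :+ (con (+ 1) :+ con (+ 0)))
                                                := (i :- x :+ con (+ 1)) :+ (x :+ (con (+ 1) :+ j))) refl (ι p) (ι n) x ⟩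
        d + e                         ∎

      ratio-suc : ratio (suc n) ≈ q * ratio n * e ⁻¹
      ratio-suc = divide-by-b′ (begin
        m * ι ((p +ℕ suc n +ℕ 1) C suc n) ≡⟨ cong (λ t → m * ι (t C suc n)) p+[1+n]+1≡1+M ⟩
        m * ι (suc M C suc n)          ≈⟨ ι-homo-* (suc n) (suc M C suc n) ⟨
        ι (suc n *ℕ (suc M C suc n))   ≡⟨ cong ι ([1+k]*[1+n]C[1+k]≡[1+n]*nCk M n) ⟩
        ι (suc M *ℕ (M C n))           ≈⟨ ι-homo-* (suc M) (M C n) ⟩
        q * ι (M C n)                  ∎)

      summand-suc : summand (suc n) ≈ ι (p +ℕ 1) * ratio n * e ⁻¹ * H M
      summand-suc = *-cong (divide-by-b′ (begin
        m * ι ((p +ℕ suc n) C suc n)   ≡⟨ cong (λ t → m * ι (t C suc n)) p+[1+n]≡M ⟩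
        m * ι (M C suc n)              ≈⟨ ι-homo-* (suc n) (M C suc n) ⟨
        ι (suc n *ℕ (M C suc n))       ≡⟨ cong ι ([1+k]*[m+k+1]C[1+k]≡[m+1]*[m+k+1]Ck p n) ⟩
        ι ((p +ℕ 1) *ℕ (M C n))        ≈⟨ ι-homo-* (p +ℕ 1) (M C n) ⟩
        ι (p +ℕ 1) * ι (M C n)         ∎))
        (reflexive (cong H p+[1+n]≡M))

      rhs-suc : rhs n + summand (suc n) ≈ rhs (suc n)
      rhs-suc = begin
        rhs n + summand (suc n)
          ≈⟨ +-congˡ summand-suc ⟩
        (A - K₁ + K₂) + T
          ≈⟨ solve 4 (λ A K₁ K₂ T → A :- K₁ :+ K₂ :+ T := (A :+ T) :- K₁ :+ K₂) refl A K₁ K₂ T ⟩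
        (A + T) - K₁ + K₂
          ≈⟨ +-congʳ (+-congʳ (telescoping-step (inverseʳ d d≉0) (inverseʳ e e≉0) (inverseʳ q (char0 M))
                                                 q≈d+e P (ratio n) (H M))) ⟨
        (P / d) * (q * ratio n * e ⁻¹) * ((H M + 1# / q) - 1# / d) - K₁ + K₂
          ≈⟨ +-congʳ (+-congʳ (*-cong (*-congˡ ratio-suc) (+-congʳ (reflexive (cong H p+[1+n]+1≡1+M))))) ⟨
        rhs (suc n) ∎
        where
        P = ι (p +ℕ 1)
        A = (P / d) * ratio n * (H M - 1# / d)
        T = P * ratio n * e ⁻¹ * H M
        K₁ = (P / d) * H p
        K₂ = x / (d * d)

    sum≈rhs : ∀ n → (∀ k → 1 ≤ k → k ≤ n → ¬ (binom (x + ι k) k ≈ 0#)) → sum1 n summand ≈ rhs n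
    sum≈rhs zero    _       = sym rhs-zero
    sum≈rhs (suc n) binom≉0 = begin
      sum1 n summand + summand (suc n)
        ≈⟨ +-congʳ (sum≈rhs n (λ k 1≤k k≤n → binom≉0 k 1≤k (ℕ.m≤n⇒m≤1+n k≤n))) ⟩
      rhs n + summand (suc n)
        ≈⟨ Step.rhs-suc n (binom≉0 (suc n) (s≤s z≤n) ℕ.≤-refl) ⟩
      rhs (suc n) ∎

theorem2 : ∀ {c ℓ} (F : Field c ℓ) → CharZero F →
    let open Field F
        open FieldOps F
    in (n : ℕ) → 1 ≤ n → (p : ℕ) → (x : Carrier) →
       ¬ (x ≈ ι (p +ℕ 1)) →
       (∀ k → 1 ≤ k → k ≤ n → ¬ (binom (x + ι k) k ≈ 0#)) →
       sum1 n (λ k → (ι ((p +ℕ k) C k) / binom (x + ι k) k) * H (p +ℕ k))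
         ≈ (ι (p +ℕ 1) / (ι p - x + 1#)) * (ι ((p +ℕ n +ℕ 1) C n) / binom (x + ι n) n)
             * (H (p +ℕ n +ℕ 1) - 1# / (ι p - x + 1#))
           - (ι (p +ℕ 1) / (ι p - x + 1#)) * H p
           + x / ((ι p - x + 1#) * (ι p - x + 1#))
-- The identity also holds for n = 0 (both sides vanish).
theorem2 F char0 n _ p x x≉p+1 binom≉0 = HarmonicBinomialSum.sum≈rhs F char0 p x x≉p+1 n binom≉0
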